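{- There exists a sequence of integral trees $(T_n)_{n\ge1}$ such that each $T_n$ contains a pair of cospectral vertices at distance $2$, and the minimum distance between two distinct elements of $\Phi(T_n)$ tends to $\infty$ as $n\to\infty$.
   Context: A graph is integral if all eigenvalues of its adjacency matrix are integers. $\Phi(T)$ denotes the set of distinct eigenvalues of the adjacency matrix of $T$. Two vertices $i,j$ of a graph $G$ are cospectral if $\phi^{G\setminus i}=\phi^{G\setminus j}$, where $\phi^H$ denotes the characteristic polynomial of the adjacency matrix of $H$ and $G\setminus v$ is the graph with vertex $v$ deleted. -}

module Defs where

open import Data.Nat using (ℕ; zero; suc; _≤_)
open import Data.Nat as ℕ using ()
open import Data.Integer using (ℤ; +_; _+_; _-_; _*_; -_; ∣_∣)
open import Data.Fin using (Fin; zero; suc; toℕ; punchIn; _≟_)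
open import Data.Bool using (Bool; true; false; if_then_else_)
open import Data.List using (List; []; _∷_; foldr; map)
open import Data.List.Membership.Propositional using (_∈_)
open import Data.Product using (Σ; _×_; _,_; ∃; ∃-syntax)
open import Relation.Nullary using (¬_; does)
open import Relation.Binary.PropositionalEquality using (_≡_; _≢_)
open import Function.Definitions using (Injective)

Matrix : ℕ → Set
Matrix n = Fin n → Fin n → ℤ

∑ : (n : ℕ) → (Fin n → ℤ) → ℤ
∑ zero    f = + 0
∑ (suc n) f = f zero + ∑ n (λ i → f (suc i))

sgn : ℕ → ℤ
sgn zero    = + 1
sgn (suc k) = - sgn k

det : (n : ℕ) → Matrix n → ℤ
det zero    M = + 1
det (suc n) M =
  ∑ (suc n) (λ j → sgn (toℕ j) * M zero j * det n (λ r c → M (suc r) (punchIn j c)))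

δ : {n : ℕ} → Fin n → Fin n → ℤ → ℤ
δ i j x = if does (i ≟ j) then x else + 0

-- characteristic polynomial φ^A(x) = det (x I - A), as a polynomial
-- function ℤ → ℤ (a polynomial over ℤ is determined by its values on ℤ)
charPoly : {n : ℕ} → Matrix n → ℤ → ℤ
charPoly {n} A x = det n (λ i j → δ i j x - A i j)

record Graph (n : ℕ) : Set where
  field
    adj   : Fin n → Fin n → Bool
    sym   : ∀ i j → adj i j ≡ adj j i
    irrfl : ∀ i → adj i i ≡ false
open Graph public

Adj : {n : ℕ} → Graph n → Fin n → Fin n → Set
Adj G i j = adj G i j ≡ true

adjMatrix : {n : ℕ} → Graph n → Matrix n
adjMatrix G i j = if adj G i j then + 1 else + 0

delete : {n : ℕ} → Graph (suc n) → Fin (suc n) → Graph n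
delete G i = record
  { adj   = λ j k → adj G (punchIn i j) (punchIn i k)
  ; sym   = λ j k → sym G (punchIn i j) (punchIn i k)
  ; irrfl = λ j → irrfl G (punchIn i j)
  }

data Walk {n : ℕ} (G : Graph n) : Fin n → Fin n → Set where
  here : ∀ {u} → Walk G u u
  step : ∀ {u v w} → Adj G u v → Walk G v w → Walk G u w

Connected : {n : ℕ} → Graph n → Set
Connected G = ∀ u v → Walk G u v

next : {m : ℕ} → Fin (suc m) → Fin (suc m)
next {m} i with Data.Fin.toℕ i ℕ.<? m
... | Relation.Nullary.yes p = Data.Fin.fromℕ< (ℕ.s≤s p)
... | Relation.Nullary.no _  = zero

Cycle : {n : ℕ} → Graph n → Set
Cycle {n} G = Σ ℕ λ k → Σ (Fin (3 ℕ.+ k) → Fin n) λ c →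
  Injective _≡_ _≡_ c × (∀ i → Adj G (c i) (c (next i)))

Acyclic : {n : ℕ} → Graph n → Set
Acyclic G = ¬ Cycle G

IsTree : {n : ℕ} → Graph n → Set
IsTree {n} G = 1 ≤ n × Connected G × Acyclic G

φ : {n : ℕ} → Graph n → ℤ → ℤ
φ G = charPoly (adjMatrix G)

-- integral: the characteristic polynomial splits into linear factors over ℤ,
-- i.e. all eigenvalues (with multiplicity) are integers
Integral : {n : ℕ} → Graph n → Set
Integral G = Σ (List ℤ) λ λs → ∀ x → φ G x ≡ foldr _*_ (+ 1) (map (λ l → x - l) λs)

-- integer eigenvalue (for an integral graph this is exactly Φ(G))
InΦ : {n : ℕ} → Graph n → ℤ → Set
InΦ G x = φ G x ≡ + 0

Cospectral : {n : ℕ} → Graph (suc n) → Fin (suc n) → Fin (suc n) → Set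
Cospectral G i j = ∀ x → φ (delete G i) x ≡ φ (delete G j) x

Dist2 : {n : ℕ} → Graph n → Fin n → Fin n → Set
Dist2 G i j = i ≢ j × ¬ Adj G i j × ∃[ k ] (Adj G i k × Adj G k j)

HasCospectralPairAtDist2 : {n : ℕ} → Graph n → Set
HasCospectralPairAtDist2 {zero}  G = Data.Empty.⊥
  where import Data.Empty
HasCospectralPairAtDist2 {suc n} G =
  ∃[ i ] ∃[ j ] (Dist2 G i j × Cospectral G i j)

GapAtLeast : {n : ℕ} → Graph n → ℕ → Set
GapAtLeast G M = ∀ a b → InΦ G a → InΦ G b → a ≢ b → M ≤ ∣ a - b ∣

{-# OPTIONS --safe #-}
-- The trees are the stars K_{1,(n+1)²}. Expanding the determinant along a leaf
-- row gives φ(K_{1,K}) = x^{K−1}(x² − K), so for K = m² the star is integral with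
-- Φ = {m, −m, 0}, whose gaps are at least m. Two leaves are at distance 2 via the
-- centre, and cospectral because deleting either one leaves K_{1,K−1}.
module Submission where

open import Defs hiding (sym)
open import Data.Nat using (ℕ; zero; suc; _≤_; s≤s; z≤n; _<?_)
open import Data.Nat as ℕ using ()
import Data.Nat.Properties as ℕ
open import Data.Integer using (ℤ; +_; _+_; _-_; _*_; -_; _^_; ∣_∣)
import Data.Integer.Properties as ℤ
open import Data.Integer.Tactic.RingSolver using (solve-∀)
open import Data.Fin using (Fin; zero; suc; toℕ; punchIn; fromℕ; inject₁; _≟_)
import Data.Fin.Properties as Fin
open import Data.Bool using (Bool; true; false; not; _xor_; if_then_else_)
open import Data.Bool.Properties using (not-involutive; xor-comm; xor-same)
open import Data.List using (List; []; _∷_; foldr; map; replicate)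
open import Data.List.Membership.Propositional using (_∈_)
open import Data.List.Relation.Unary.Any using (here; there)
open import Data.Product using (Σ; _×_; _,_; ∃-syntax)
open import Data.Sum using (_⊎_; inj₁; inj₂)
open import Data.Empty using (⊥; ⊥-elim)
open import Function using (_∘_)
open import Function.Definitions using (Injective)
open import Relation.Nullary using (yes; no)
open import Relation.Nullary.Decidable using (dec-true; dec-false)
open import Relation.Binary.PropositionalEquality
open ≡-Reasoning

∑-cong : ∀ n {f g : Fin n → ℤ} → (∀ i → f i ≡ g i) → ∑ n f ≡ ∑ n g
∑-cong zero    f≗g = refl
∑-cong (suc n) f≗g = cong₂ _+_ (f≗g zero) (∑-cong n (f≗g ∘ suc))

∑-zero : ∀ n {f : Fin n → ℤ} → (∀ i → f i ≡ + 0) → ∑ n f ≡ + 0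
∑-zero zero    f≡0 = refl
∑-zero (suc n) f≡0 = cong₂ _+_ (f≡0 zero) (∑-zero n (f≡0 ∘ suc))

∑-single : ∀ n {f : Fin n → ℤ} k → (∀ i → i ≢ k → f i ≡ + 0) → ∑ n f ≡ f k
∑-single (suc n) {f} zero f≡0 = begin
  f zero + ∑ n (f ∘ suc) ≡⟨ cong (_+_ (f zero)) (∑-zero n (λ i → f≡0 (suc i) λ ())) ⟩
  f zero + + 0           ≡⟨ ℤ.+-identityʳ (f zero) ⟩
  f zero                 ∎
∑-single (suc n) {f} (suc k) f≡0 = begin
  f zero + ∑ n (f ∘ suc) ≡⟨ cong (_+ ∑ n (f ∘ suc)) (f≡0 zero λ ()) ⟩
  + 0 + ∑ n (f ∘ suc)    ≡⟨ ℤ.+-identityˡ _ ⟩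
  ∑ n (f ∘ suc)          ≡⟨ ∑-single n k (λ i i≢k → f≡0 (suc i) (i≢k ∘ Fin.suc-injective)) ⟩
  f (suc k)              ∎

δ-refl : ∀ {n} (i : Fin n) x → δ i i x ≡ x
δ-refl i x = cong (if_then x else + 0) (dec-true (i ≟ i) refl)

δ-≢ : ∀ {n} {i j : Fin n} x → i ≢ j → δ i j x ≡ + 0
δ-≢ {i = i} {j} x i≢j = cong (if_then x else + 0) (dec-false (i ≟ j) i≢j)

δ-injective : ∀ {m n} {f : Fin m → Fin n} → Injective _≡_ _≡_ f →
              ∀ i j x → δ (f i) (f j) x ≡ δ i j x
δ-injective {f = f} f-inj i j x with i ≟ j
... | yes refl = δ-refl (f i) x
... | no i≢j   = δ-≢ x (i≢j ∘ f-inj)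

zero-entry-term : ∀ s d {a} → a ≡ + 0 → s * a * d ≡ + 0
zero-entry-term s d refl = trans (cong (_* d) (ℤ.*-zeroʳ s)) (ℤ.*-zeroˡ d)

charMatrix : ∀ {n} → Matrix n → ℤ → Matrix n
charMatrix A x i j = δ i j x - A i j

minor : ∀ {n} → Matrix (suc n) → Fin (suc n) → Matrix n
minor M j r c = M (suc r) (punchIn j c)

det-cong : ∀ n {M N : Matrix n} → (∀ i j → M i j ≡ N i j) → det n M ≡ det n N
det-cong zero    M≗N = refl
det-cong (suc n) M≗N = ∑-cong (suc n) λ j →
  cong₂ (λ a b → sgn (toℕ j) * a * b) (M≗N zero j) (det-cong n (λ r c → M≗N (suc r) (punchIn j c)))

det-expand-single : ∀ n (M : Matrix (suc n)) k → (∀ j → j ≢ k → M zero j ≡ + 0) →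
                    det (suc n) M ≡ sgn (toℕ k) * M zero k * det n (minor M k)
det-expand-single n M k M₀≡0 = ∑-single (suc n) k λ j j≢k →
  zero-entry-term (sgn (toℕ j)) (det n (minor M j)) (M₀≡0 j j≢k)

det₁ : (M : Matrix 1) → det 1 M ≡ M zero zero
det₁ M = begin
  + 1 * M zero zero * + 1 + + 0 ≡⟨ ℤ.+-identityʳ _ ⟩
  + 1 * M zero zero * + 1       ≡⟨ ℤ.*-identityʳ _ ⟩
  + 1 * M zero zero             ≡⟨ ℤ.*-identityˡ _ ⟩
  M zero zero                   ∎

-- Row r (for r < n) is x times the unit vector e_{r+1}: only the first column
-- of the last row survives the expansion.
det-shiftedDiagonal : ∀ x n (M : Matrix (suc n)) → (∀ r c → M (inject₁ r) c ≡ δ (suc r) c x) →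
                      det (suc n) M ≡ sgn n * x ^ n * M (fromℕ n) zero
det-shiftedDiagonal x zero M _ = trans (det₁ M) (sym (ℤ.*-identityˡ (M zero zero)))
det-shiftedDiagonal x (suc n) M shifted = begin
  det (suc (suc n)) M
    ≡⟨ det-expand-single (suc n) M (suc zero) (λ j j≢1 → trans (shifted zero j) (δ-≢ x (j≢1 ∘ sym))) ⟩
  sgn 1 * M zero (suc zero) * det (suc n) (minor M (suc zero))
    ≡⟨ cong₂ (λ a b → sgn 1 * a * b) (trans (shifted zero (suc zero)) (δ-refl {suc (suc n)} (suc zero) x))
             (det-shiftedDiagonal x n (minor M (suc zero)) shifted′) ⟩
  sgn 1 * x * (sgn n * x ^ n * M (fromℕ (suc n)) zero)
    ≡⟨ reassociate x (sgn n) (x ^ n) (M (fromℕ (suc n)) zero) ⟩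
  sgn (suc n) * x ^ suc n * M (fromℕ (suc n)) zero ∎
  where
  shifted′ : ∀ r c → minor M (suc zero) (inject₁ r) c ≡ δ (suc r) c x
  shifted′ r c = trans (shifted (suc r) (punchIn (suc zero) c))
                       (δ-injective (Fin.punchIn-injective (suc zero) _ _) (suc r) c x)
  reassociate : ∀ x s p m → - (+ 1) * x * (s * p * m) ≡ - s * (x * p) * m
  reassociate = solve-∀

sgn-square : ∀ k → sgn k * sgn k ≡ + 1
sgn-square zero    = refl
sgn-square (suc k) = trans (neg-square (sgn k)) (sgn-square k)
  where
  neg-square : ∀ s → - s * - s ≡ s * s
  neg-square = solve-∀

isLast : ∀ {n} → Fin (suc n) → Bool
isLast {zero}  zero    = true
isLast {suc n} zero    = false
isLast {suc n} (suc i) = isLast i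

isLast-fromℕ : ∀ n → isLast (fromℕ n) ≡ true
isLast-fromℕ zero    = refl
isLast-fromℕ (suc n) = isLast-fromℕ n

isLast-inject₁ : ∀ {n} (i : Fin n) → isLast (inject₁ i) ≡ false
isLast-inject₁ {suc n} zero    = refl
isLast-inject₁ {suc n} (suc i) = isLast-inject₁ i

isLast⇒≡fromℕ : ∀ {n} (i : Fin (suc n)) → isLast i ≡ true → i ≡ fromℕ n
isLast⇒≡fromℕ {zero}  zero    _      = refl
isLast⇒≡fromℕ {suc n} (suc i) isLast = cong suc (isLast⇒≡fromℕ i isLast)

≢fromℕ⇒¬isLast : ∀ {n} (i : Fin (suc n)) → i ≢ fromℕ n → isLast i ≡ false
≢fromℕ⇒¬isLast i i≢last with isLast i in isLast-i
... | true  = ⊥-elim (i≢last (isLast⇒≡fromℕ i isLast-i))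
... | false = refl

isLast-punchIn₁ : ∀ {n} (i : Fin (suc (suc n))) → isLast (punchIn (suc zero) i) ≡ isLast i
isLast-punchIn₁ zero    = refl
isLast-punchIn₁ (suc i) = refl

punchIn-fromℕ : ∀ {n} (i : Fin n) → punchIn (fromℕ n) i ≡ inject₁ i
punchIn-fromℕ {suc n} zero    = refl
punchIn-fromℕ {suc n} (suc i) = cong suc (punchIn-fromℕ i)

xor≡true⇒≡not : ∀ a b → a xor b ≡ true → b ≡ not a
xor≡true⇒≡not true  false _ = refl
xor≡true⇒≡not false true  _ = refl

-- The star K_{1,K}: leaves 0, …, K − 1 and centre K.
star : (K : ℕ) → Graph (suc K)
star K = record
  { adj   = λ i j → isLast i xor isLast j
  ; sym   = λ i j → xor-comm (isLast i) (isLast j)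
  ; irrfl = λ i → xor-same (isLast i)
  }

Adj-sym : ∀ {n} (G : Graph n) {u v} → Adj G u v → Adj G v u
Adj-sym G {u} {v} u~v = trans (Graph.sym G v u) u~v

star-alternates : ∀ {K} {u v : Fin (suc K)} → Adj (star K) u v → isLast v ≡ not (isLast u)
star-alternates {u = u} {v} = xor≡true⇒≡not (isLast u) (isLast v)

star-spoke : ∀ K (u : Fin (suc K)) → u ≡ fromℕ K ⊎ Adj (star K) u (fromℕ K)
star-spoke K u with isLast u in isLast-u
... | true  = inj₁ (isLast⇒≡fromℕ u isLast-u)
... | false = inj₂ (isLast-fromℕ K)

star-connected : ∀ K → Connected (star K)
star-connected K u v with star-spoke K u | star-spoke K v
... | inj₁ refl | inj₁ refl = here
... | inj₁ refl | inj₂ v~c  = step (Adj-sym (star K) v~c) here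
... | inj₂ u~c  | inj₁ refl = step u~c here
... | inj₂ u~c  | inj₂ v~c  = step u~c (step (Adj-sym (star K) v~c) here)

next-cases : ∀ {m} (i : Fin (suc m)) → toℕ (next i) ≡ suc (toℕ i) ⊎ next i ≡ zero
next-cases {m} i with toℕ i <? m
... | yes i<m = inj₁ (Fin.toℕ-fromℕ< (s≤s i<m))
... | no  _   = inj₂ refl

-- Along a closed walk centre and leaves alternate, so c₀ = c₂ (if c₀ is the
-- centre) or c₁ = c₃ (if c₁ is); a cycle of length ≥ 3 rules out both.
star-acyclic : ∀ K → Acyclic (star K)
star-acyclic K (k , c , c-injective , c-adj) = by-c₀ (isLast (c zero)) refl
  where
  two-steps : ∀ i → isLast (c (next (next i))) ≡ isLast (c i)
  two-steps i = begin
    isLast (c (next (next i))) ≡⟨ star-alternates {K} (c-adj (next i)) ⟩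
    not (isLast (c (next i)))  ≡⟨ cong not (star-alternates {K} (c-adj i)) ⟩
    not (not (isLast (c i)))   ≡⟨ not-involutive _ ⟩
    isLast (c i)               ∎
  returns-to-centre : ∀ i → isLast (c i) ≡ true → i ≡ next (next i)
  returns-to-centre i centre = c-injective (trans (isLast⇒≡fromℕ _ centre)
    (sym (isLast⇒≡fromℕ _ (trans (two-steps i) centre))))
  1≢3 : suc zero ≢ next (next (suc zero))
  1≢3 1≡3 with next-cases {suc (suc k)} (suc (suc zero))
  ... | inj₁ toℕ-3≡3 with trans (cong toℕ 1≡3) toℕ-3≡3
  ...   | ()
  1≢3 1≡3 | inj₂ 3≡0 with trans 1≡3 3≡0
  ... | ()
  by-c₀ : ∀ b → isLast (c zero) ≡ b → ⊥
  by-c₀ true  c₀ with returns-to-centre zero c₀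
  ... | ()
  by-c₀ false c₀ = 1≢3 (returns-to-centre (suc zero) (trans (star-alternates {K} (c-adj zero)) (cong not c₀)))

star-isTree : ∀ K → IsTree (star K)
star-isTree K = s≤s z≤n , star-connected K , star-acyclic K

φ-cong : ∀ {n} (G H : Graph n) → (∀ i j → adj G i j ≡ adj H i j) → ∀ x → φ G x ≡ φ H x
φ-cong G H G≗H x = det-cong _ λ i j → cong (λ b → δ i j x - (if b then + 1 else + 0)) (G≗H i j)

star-leaves-cospectral : ∀ k → Cospectral (star (suc (suc k))) zero (suc zero)
star-leaves-cospectral k = φ-cong (delete (star (suc (suc k))) zero) (delete (star (suc (suc k))) (suc zero))
  λ i j → sym (cong₂ _xor_ (isLast-punchIn₁ {k} i) (isLast-punchIn₁ {k} j))

star-leaves-dist2 : ∀ k → Dist2 (star (suc (suc k))) zero (suc zero)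
star-leaves-dist2 k = (λ ()) , (λ ()) , fromℕ (suc (suc k)) ,
  isLast-fromℕ (suc k) , cong (_xor false) (isLast-fromℕ (suc k))

star-cospectral-pair : ∀ k → HasCospectralPairAtDist2 (star (suc (suc k)))
star-cospectral-pair k = zero , suc zero , star-leaves-dist2 k , star-leaves-cospectral k

φ-star-zero : ∀ x → φ (star 0) x ≡ x
φ-star-zero x = trans (det₁ (charMatrix (adjMatrix (star 0)) x)) (ℤ.+-identityʳ x)

-- Expansion along the row of leaf 0, whose only nonzero entries are x on the
-- diagonal and −1 in the centre column.
φ-star-suc : ∀ n x → φ (star (suc n)) x ≡ x * φ (star n) x - x ^ n
φ-star-suc n x = begin
  f zero + ∑ (suc n) (f ∘ suc) ≡⟨ cong (_+_ (f zero)) (∑-single (suc n) (fromℕ n) leaf-term) ⟩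
  f zero + f (fromℕ (suc n))   ≡⟨ cong₂ _+_ diagonal-term centre-term ⟩
  x * φ (star n) x - x ^ n     ∎
  where
  M : Matrix (suc (suc n))
  M = charMatrix (adjMatrix (star (suc n))) x
  f : Fin (suc (suc n)) → ℤ
  f j = sgn (toℕ j) * M zero j * det (suc n) (minor M j)
  leaf-term : ∀ i → i ≢ fromℕ n → f (suc i) ≡ + 0
  leaf-term i i≢c = zero-entry-term (sgn (toℕ (suc i))) (det (suc n) (minor M (suc i)))
    (cong (λ b → + 0 - (if b then + 1 else + 0)) (≢fromℕ⇒¬isLast i i≢c))
  diagonal-term : f zero ≡ x * φ (star n) x
  diagonal-term = cong (_* φ (star n) x) (trans (ℤ.*-identityˡ _) (ℤ.+-identityʳ x))
  centre-row : ∀ r c → minor M (fromℕ (suc n)) (inject₁ r) c ≡ δ (suc r) c x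
  centre-row r c = begin
    M (suc (inject₁ r)) (punchIn (fromℕ (suc n)) c)
      ≡⟨ cong (M (suc (inject₁ r))) (punchIn-fromℕ c) ⟩
    δ (inject₁ (suc r)) (inject₁ c) x - (if isLast (inject₁ r) xor isLast (inject₁ c) then + 1 else + 0)
      ≡⟨ cong₂ (λ a b → δ (inject₁ (suc r)) (inject₁ c) x - (if a xor b then + 1 else + 0))
               (isLast-inject₁ r) (isLast-inject₁ c) ⟩
    δ (inject₁ (suc r)) (inject₁ c) x - + 0
      ≡⟨ ℤ.+-identityʳ _ ⟩
    δ (inject₁ (suc r)) (inject₁ c) x
      ≡⟨ δ-injective Fin.inject₁-injective (suc r) c x ⟩
    δ (suc r) c x ∎
  centre-minor : det (suc n) (minor M (fromℕ (suc n))) ≡ sgn n * x ^ n * - (+ 1)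
  centre-minor = trans (det-shiftedDiagonal x n (minor M (fromℕ (suc n))) centre-row)
    (cong (λ b → sgn n * x ^ n * (+ 0 - (if b xor false then + 1 else + 0))) (isLast-fromℕ n))
  collect : ∀ s p → - s * - (+ 1) * (s * p * - (+ 1)) ≡ - (s * s * p)
  collect = solve-∀
  centre-term : f (fromℕ (suc n)) ≡ - (x ^ n)
  centre-term = begin
    sgn (toℕ (fromℕ (suc n))) * M zero (fromℕ (suc n)) * det (suc n) (minor M (fromℕ (suc n)))
      ≡⟨ cong₂ (λ a b → sgn a * M zero (fromℕ (suc n)) * b) (Fin.toℕ-fromℕ (suc n)) centre-minor ⟩
    sgn (suc n) * M zero (fromℕ (suc n)) * (sgn n * x ^ n * - (+ 1))
      ≡⟨ cong (λ b → sgn (suc n) * (+ 0 - (if b then + 1 else + 0)) * (sgn n * x ^ n * - (+ 1)))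
              (isLast-fromℕ n) ⟩
    sgn (suc n) * - (+ 1) * (sgn n * x ^ n * - (+ 1))
      ≡⟨ collect (sgn n) (x ^ n) ⟩
    - (sgn n * sgn n * x ^ n)
      ≡⟨ cong (λ t → - (t * x ^ n)) (sgn-square n) ⟩
    - (+ 1 * x ^ n)
      ≡⟨ cong -_ (ℤ.*-identityˡ (x ^ n)) ⟩
    - (x ^ n) ∎

φ-star : ∀ k x → φ (star (suc k)) x ≡ x ^ k * (x * x - + suc k)
φ-star zero x = begin
  φ (star 1) x             ≡⟨ φ-star-suc 0 x ⟩
  x * φ (star 0) x - x ^ 0 ≡⟨ cong (λ p → x * p - x ^ 0) (φ-star-zero x) ⟩
  x * x - + 1              ≡⟨ sym (ℤ.*-identityˡ _) ⟩
  x ^ 0 * (x * x - + 1)    ∎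
φ-star (suc k) x = begin
  φ (star (suc (suc k))) x                    ≡⟨ φ-star-suc (suc k) x ⟩
  x * φ (star (suc k)) x - x ^ suc k          ≡⟨ cong (λ p → x * p - x ^ suc k) (φ-star k x) ⟩
  x * (x ^ k * (x * x - + suc k)) - x * x ^ k ≡⟨ collect x (x ^ k) (+ suc k) ⟩
  x * x ^ k * (x * x - (+ 1 + + suc k))       ∎
  where
  collect : ∀ x p c → x * (p * (x * x - c)) - x * p ≡ x * p * (x * x - (+ 1 + c))
  collect = solve-∀

rootProduct : List ℤ → ℤ → ℤ
rootProduct λs x = foldr _*_ (+ 1) (map (λ l → x - l) λs)

rootProduct-zeros : ∀ k x → rootProduct (replicate k (+ 0)) x ≡ x ^ k
rootProduct-zeros zero    x = refl
rootProduct-zeros (suc k) x = cong₂ _*_ (ℤ.+-identityʳ x) (rootProduct-zeros k x)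

rootProduct≡0⇒∈ : ∀ λs x → rootProduct λs x ≡ + 0 → x ∈ λs
rootProduct≡0⇒∈ (l ∷ λs) x ∏≡0 with ℤ.i*j≡0⇒i≡0∨j≡0 (x - l) ∏≡0
... | inj₁ x-l≡0 = here (ℤ.i-j≡0⇒i≡j x l x-l≡0)
... | inj₂ ∏′≡0  = there (rootProduct≡0⇒∈ λs x ∏′≡0)

∈-replicate⇒≡ : ∀ {A : Set} {a b : A} k → a ∈ replicate k b → a ≡ b
∈-replicate⇒≡ (suc k) (here a≡b) = a≡b
∈-replicate⇒≡ (suc k) (there a∈) = ∈-replicate⇒≡ k a∈

squareStarSpectrum : ℕ → List ℤ
squareStarSpectrum m = + m ∷ - (+ m) ∷ replicate (ℕ.pred (m ℕ.* m)) (+ 0)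

squareStarΦ : ℕ → List ℤ
squareStarΦ m = + m ∷ - (+ m) ∷ + 0 ∷ []

φ-squareStar : ∀ m x → φ (star (suc m ℕ.* suc m)) x ≡ rootProduct (squareStarSpectrum (suc m)) x
φ-squareStar m x = begin
  φ (star (suc k)) x
    ≡⟨ φ-star k x ⟩
  x ^ k * (x * x - + (suc m ℕ.* suc m))
    ≡⟨ cong (λ c → x ^ k * (x * x - c)) (ℤ.pos-* (suc m) (suc m)) ⟩
  x ^ k * (x * x - + suc m * + suc m)
    ≡⟨ difference-of-squares x (+ suc m) (x ^ k) ⟩
  (x - + suc m) * ((x - - (+ suc m)) * x ^ k)
    ≡⟨ cong (λ p → (x - + suc m) * ((x - - (+ suc m)) * p)) (sym (rootProduct-zeros k x)) ⟩
  rootProduct (squareStarSpectrum (suc m)) x ∎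
  where
  k = m ℕ.+ m ℕ.* suc m
  difference-of-squares : ∀ x a p → p * (x * x - a * a) ≡ (x - a) * ((x - - a) * p)
  difference-of-squares = solve-∀

squareStar-integral : ∀ m → Integral (star (suc m ℕ.* suc m))
squareStar-integral m = squareStarSpectrum (suc m) , φ-squareStar m

squareStar-eigenvalue : ∀ m a → InΦ (star (suc m ℕ.* suc m)) a → a ∈ squareStarΦ (suc m)
squareStar-eigenvalue m a φa≡0 with rootProduct≡0⇒∈ (squareStarSpectrum (suc m)) a (trans (sym (φ-squareStar m a)) φa≡0)
... | here a≡m           = here a≡m
... | there (here a≡-m)  = there (here a≡-m)
... | there (there a∈0s) = there (there (here (∈-replicate⇒≡ (m ℕ.+ m ℕ.* suc m) a∈0s)))

squareStarΦ-gap : ∀ n {a b} → a ∈ squareStarΦ (suc n) → b ∈ squareStarΦ (suc n) → a ≢ b →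
                  suc n ≤ ∣ a - b ∣
squareStarΦ-gap n (here refl)               (here refl)               a≢b = ⊥-elim (a≢b refl)
squareStarΦ-gap n (here refl)               (there (here refl))       _   = ℕ.m≤m+n (suc n) (suc n)
squareStarΦ-gap n (here refl)               (there (there (here refl))) _ = ℕ.m≤m+n (suc n) 0
squareStarΦ-gap n (there (here refl))       (here refl)               _   = ℕ.m≤n⇒m≤1+n (s≤s (ℕ.m≤m+n n n))
squareStarΦ-gap n (there (here refl))       (there (here refl))       a≢b = ⊥-elim (a≢b refl)
squareStarΦ-gap n (there (here refl))       (there (there (here refl))) _ =
  ℕ.≤-reflexive (cong ∣_∣ (sym (ℤ.+-identityʳ (- (+ suc n)))))
squareStarΦ-gap n (there (there (here refl))) (here refl)             _   = ℕ.≤-refl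
squareStarΦ-gap n (there (there (here refl))) (there (here refl))     _   = ℕ.≤-refl
squareStarΦ-gap n (there (there (here refl))) (there (there (here refl))) a≢b = ⊥-elim (a≢b refl)

squareStar-gap : ∀ n → GapAtLeast (star (suc n ℕ.* suc n)) (suc n)
squareStar-gap n a b φa≡0 φb≡0 =
  squareStarΦ-gap n (squareStar-eigenvalue n a φa≡0) (squareStar-eigenvalue n b φb≡0)

GapAtLeast-mono : ∀ {n} {G : Graph n} {M N} → M ≤ N → GapAtLeast G N → GapAtLeast G M
GapAtLeast-mono M≤N gap a b φa φb a≢b = ℕ.≤-trans M≤N (gap a b φa φb a≢b)

theorem20 : Σ (ℕ → ℕ) λ sz → Σ ((n : ℕ) → Graph (sz n)) λ T →
    (∀ n → 1 ≤ n → IsTree (T n) × Integral (T n) × HasCospectralPairAtDist2 (T n))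
    × (∀ M → ∃[ N ] (∀ n → 1 ≤ n → N ≤ n → GapAtLeast (T n) M))
theorem20 = (λ n → suc (square n)) , (λ n → star (square n)) , trees , gaps
  where
  square : ℕ → ℕ
  square n = suc n ℕ.* suc n
  trees : ∀ n → 1 ≤ n →
          IsTree (star (square n)) × Integral (star (square n)) × HasCospectralPairAtDist2 (star (square n))
  trees (suc n) _ = star-isTree _ , squareStar-integral (suc n) , star-cospectral-pair _
  gaps : ∀ M → ∃[ N ] (∀ n → 1 ≤ n → N ≤ n → GapAtLeast (star (square n)) M)
  gaps M = M , λ n _ M≤n → GapAtLeast-mono {G = star (square n)} (ℕ.m≤n⇒m≤1+n M≤n) (squareStar-gap n)
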